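{- If $G$ is a connected graph with $\operatorname{diam}(G)=2$ that has no true twins, and $k\ge 1$, then $\mathrm{gp}_{\rm o}(G^{k,\boxtimes})=\alpha(G^{k,\boxtimes})$.
   Context: All graphs are finite and simple. For $X\subseteq V(G)$, two vertices $u,v$ are $X$-positionable if no shortest $u,v$-path has an internal vertex in $X$. $X$ is an outer general position set if every two vertices of $X$ are $X$-positionable and every $u\in X$, $v\in V(G)\setminus X$ are $X$-positionable; $\mathrm{gp}_{\rm o}$ is the maximum cardinality of such a set. Vertices $u,v$ are true twins if $N_G[u]=N_G[v]$. The strong product $G\boxtimes H$ has vertex set $V(G)\times V(H)$, with $(g,h)$ and $(g',h')$ adjacent iff either $g=g'$ and $hh'\in E(H)$, or $gg'\in E(G)$ and $h=h'$, or $gg'\in E(G)$ and $hh'\in E(H)$. $G^{k,\boxtimes}$ is the strong product of $k$ copies of $G$. $\alpha$ is the independence number. -}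

module Defs where

open import Level using (0ℓ)
open import Data.Nat using (ℕ; zero; suc; _≤_)
open import Data.Product using (Σ; ∃; ∃-syntax; _×_; _,_)
open import Data.Product.Properties using (≡-dec)
open import Data.Sum using (_⊎_; inj₁; inj₂)
open import Data.Empty using (⊥)
open import Data.Unit using (⊤; tt)
open import Data.List using (List; length; cartesianProduct; [_])
open import Data.List.Membership.Propositional using (_∈_; _∉_)
open import Data.List.Membership.Propositional.Properties using (∈-cartesianProduct⁺)
open import Data.List.Relation.Unary.Any using (here)
open import Data.List.Relation.Unary.Unique.Propositional using (Unique)
open import Relation.Nullary using (¬_; Dec; yes; no)
open import Relation.Nullary.Decidable using (_⊎-dec_; _×-dec_)
open import Relation.Binary.PropositionalEquality using (_≡_; refl; sym)
open import Relation.Binary.Definitions using (DecidableEquality)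

record Graph : Set₁ where
  field
    V        : Set
    _≟_      : DecidableEquality V
    vertices : List V
    complete : ∀ v → v ∈ vertices
    Adj      : V → V → Set
    adj?     : ∀ u v → Dec (Adj u v)
    sym-adj  : ∀ {u v} → Adj u v → Adj v u
    irrefl   : ∀ {u} → ¬ Adj u u

open Graph public

SAdj : (G H : Graph) → V G × V H → V G × V H → Set
SAdj G H (g , h) (g' , h') =
  ((g ≡ g') × Adj H h h') ⊎ ((Adj G g g' × h ≡ h') ⊎ (Adj G g g' × Adj H h h'))

_⊠_ : Graph → Graph → Graph
G ⊠ H = record
  { V = V G × V H
  ; _≟_ = ≡-dec (_≟_ G) (_≟_ H)
  ; vertices = cartesianProduct (vertices G) (vertices H)
  ; complete = λ { (g , h) → ∈-cartesianProduct⁺ (complete G g) (complete H h) }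
  ; Adj = SAdj G H
  ; adj? = λ { (g , h) (g' , h') →
      ((_≟_ G g g') ×-dec adj? H h h') ⊎-dec
      (((adj? G g g') ×-dec (_≟_ H h h')) ⊎-dec ((adj? G g g') ×-dec adj? H h h')) }
  ; sym-adj = λ { (inj₁ (refl , a)) → inj₁ (refl , sym-adj H a)
                ; (inj₂ (inj₁ (a , refl))) → inj₂ (inj₁ (sym-adj G a , refl))
                ; (inj₂ (inj₂ (a , b))) → inj₂ (inj₂ (sym-adj G a , sym-adj H b)) }
  ; irrefl = λ { (inj₁ (_ , a)) → irrefl H a
               ; (inj₂ (inj₁ (a , _))) → irrefl G a
               ; (inj₂ (inj₂ (a , _))) → irrefl G a }
  }

K₁ : Graph
K₁ = record
  { V = ⊤ ; _≟_ = λ { tt tt → yes refl } ; vertices = [ tt ]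
  ; complete = λ { tt → here refl } ; Adj = λ _ _ → ⊥
  ; adj? = λ _ _ → no (λ ()) ; sym-adj = λ () ; irrefl = λ () }

-- G^{k,⊠}: strong product of k copies of G (G^{1,⊠} = G,
-- G^{k+1,⊠} = G ⊠ G^{k,⊠}); the k = 0 case is K₁ and is never used.
_^⊠_ : Graph → ℕ → Graph
G ^⊠ zero = K₁
G ^⊠ suc zero = G
G ^⊠ suc (suc k) = G ⊠ (G ^⊠ suc k)

module _ (G : Graph) where

  data Walk : V G → V G → ℕ → Set where
    [] : ∀ {u} → Walk u u zero
    _∷_ : ∀ {u w v n} → Adj G u w → Walk w v n → Walk u v (suc n)

  -- A shortest u,v-path: a walk of length n with no shorter u,v-walk
  -- (shortest walks are paths).
  IsShortest : ∀ {u v n} → Walk u v n → Set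
  IsShortest {u} {v} {n} _ = ∀ m → Walk u v m → n ≤ m

  Internal : ∀ {u v n} → Walk u v n → V G → Set
  Internal [] x = ⊥
  Internal (_ ∷ []) x = ⊥
  Internal (_∷_ {w = w} _ (a ∷ p)) x = (x ≡ w) ⊎ Internal (a ∷ p) x

  Positionable : List (V G) → V G → V G → Set
  Positionable X u v =
    ∀ n (p : Walk u v n) → IsShortest p → ∀ x → Internal p x → x ∉ X

  IsOuterGP : List (V G) → Set
  IsOuterGP X =
    (∀ u v → u ∈ X → v ∈ X → Positionable X u v) ×
    (∀ u v → u ∈ X → v ∉ X → Positionable X u v)

  IsIndependent : List (V G) → Set
  IsIndependent X = ∀ u v → u ∈ X → v ∈ X → ¬ Adj G u v

  -- m is the maximum cardinality of a vertex set satisfying P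
  -- (vertex sets are duplicate-free lists).
  IsMaxCard : (List (V G) → Set) → ℕ → Set
  IsMaxCard P m =
    (∃[ X ] (Unique X × P X × length X ≡ m)) ×
    (∀ X → Unique X → P X → length X ≤ m)

  GpoNumber : ℕ → Set
  GpoNumber = IsMaxCard IsOuterGP

  IndependenceNumber : ℕ → Set
  IndependenceNumber = IsMaxCard IsIndependent

  Connected : Set
  Connected = ∀ u v → ∃[ n ] Walk u v n

  Diameter : ℕ → Set
  Diameter d =
    (∀ u v → ∃[ n ] (n ≤ d × Walk u v n)) ×
    (∃[ u ] ∃[ v ] Σ (Walk u v d) IsShortest)

  N[_]∋_ : V G → V G → Set
  N[ u ]∋ w = (w ≡ u) ⊎ Adj G u w

  TrueTwins : V G → V G → Set
  TrueTwins u v = ∀ w → (N[ u ]∋ w → N[ v ]∋ w) × (N[ v ]∋ w → N[ u ]∋ w)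

  NoTrueTwins : Set
  NoTrueTwins = ∀ u v → ¬ (u ≡ v) → ¬ TrueTwins u v

-- In a graph in which any two vertices are at distance at most 2, a shortest
-- path has at most one internal vertex, and that vertex is adjacent to both
-- ends; hence every independent set is an outer general position set.
-- Conversely, if u, v are adjacent vertices of an outer general position set
-- X, then N[u] ⊆ N[v]: a vertex w ∈ N[u] ∖ N[v] would make v, u, w a shortest
-- path with the internal vertex u ∈ X. By symmetry u, v would be true twins.
-- Both hypotheses pass to strong products, since N[(g, h)] = N[g] × N[h].
module Submission where

open import Defs
open import Data.Nat using (ℕ; _≤_; zero; suc; z≤n; s≤s)
open import Data.Nat.Properties using (≤-trans)
open import Data.Product using (∃-syntax; _×_; _,_; proj₁; proj₂)
open import Data.Sum using (inj₁; inj₂)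
open import Data.Empty using (⊥-elim)
import Data.Fin as Fin
open Fin using (Fin)
open import Data.Fin.Properties using (injective⇒≤)
open import Data.List using (List; []; _∷_; [_]; length; lookup; filter; cartesianProductWith)
open import Data.List.Extrema.Nat using (argmax; argmax-all; f[xs]≤f[argmax])
open import Data.List.Membership.Propositional using (_∈_)
open import Data.List.Membership.Propositional.Properties
  using (∈-lookup; ∈-cartesianProductWith⁺; ∈-filter⁺; ∈-filter⁻)
open import Data.List.Membership.Setoid.Properties using (index-injective)
open import Data.List.Membership.DecPropositional using (_∈?_)
open import Data.List.Relation.Binary.Subset.Propositional using (_⊆_)
open import Data.List.Relation.Unary.Any using (here; there; index)
import Data.List.Relation.Unary.All as All
open import Data.List.Relation.Unary.AllPairs using ([]; _∷_)
open import Data.List.Relation.Unary.Unique.Propositional using (Unique)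
open import Data.List.Relation.Unary.Unique.DecPropositional using (unique?)
open import Function.Definitions using (Injective)
open import Relation.Nullary using (¬_; Dec; yes; no; ¬?)
open import Relation.Nullary.Decidable using (_⊎-dec_; _×-dec_; map′)
open import Relation.Unary using (Decidable)
open import Relation.Binary.PropositionalEquality using (_≡_; refl; sym; cong; setoid)

module _ {A : Set} where

  lookup-injective : ∀ {xs : List A} {i j} → Unique xs → lookup xs i ≡ lookup xs j → i ≡ j
  lookup-injective {_ ∷ _} {Fin.zero}  {Fin.zero}  _          _  = refl
  lookup-injective {_ ∷ _} {Fin.zero}  {Fin.suc j} (x∉ ∷ _)   eq = ⊥-elim (All.lookup x∉ (∈-lookup j) eq)
  lookup-injective {_ ∷ _} {Fin.suc i} {Fin.zero}  (x∉ ∷ _)   eq = ⊥-elim (All.lookup x∉ (∈-lookup i) (sym eq))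
  lookup-injective {_ ∷ _} {Fin.suc i} {Fin.suc j} (_ ∷ uniq) eq = cong Fin.suc (lookup-injective uniq eq)

  unique-⊆⇒length≤ : ∀ {xs ys : List A} → Unique xs → xs ⊆ ys → length xs ≤ length ys
  unique-⊆⇒length≤ {xs} {ys} uniq xs⊆ys = injective⇒≤ position-injective
    where
    position : Fin (length xs) → Fin (length ys)
    position i = index (xs⊆ys (∈-lookup i))

    position-injective : Injective _≡_ _≡_ position
    position-injective eq =
      lookup-injective uniq (index-injective (setoid A) (xs⊆ys (∈-lookup _)) (xs⊆ys (∈-lookup _)) eq)

  listsOfLength≤ : ℕ → List A → List (List A)
  listsOfLength≤ zero    xs = [ [] ]
  listsOfLength≤ (suc n) xs = [] ∷ cartesianProductWith _∷_ xs (listsOfLength≤ n xs)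

  ∈-listsOfLength≤ : ∀ {n xs} {ys : List A} → ys ⊆ xs → length ys ≤ n → ys ∈ listsOfLength≤ n xs
  ∈-listsOfLength≤ {zero}  {ys = []}     _      _         = here refl
  ∈-listsOfLength≤ {suc n} {ys = []}     _      _         = here refl
  ∈-listsOfLength≤ {suc n} {ys = y ∷ ys} ys⊆xs (s≤s len) =
    there (∈-cartesianProductWith⁺ _∷_ (ys⊆xs (here refl)) (∈-listsOfLength≤ (λ y∈ → ys⊆xs (there y∈)) len))

module _ (H : Graph) where

  maxCard-exists : (P : List (V H) → Set) → Decidable P → P [] → ∃[ m ] IsMaxCard H P m
  maxCard-exists P P? P[] =
    length largest , (largest , proj₁ largest-ok , proj₂ largest-ok , refl) , largest-max
    where
    candidate? : Decidable (λ X → Unique X × P X)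
    candidate? X = unique? (_≟_ H) X ×-dec P? X

    shortLists : List (List (V H))
    shortLists = listsOfLength≤ (length (vertices H)) (vertices H)

    candidates : List (List (V H))
    candidates = filter candidate? shortLists

    candidates-ok : All.All (λ X → Unique X × P X) candidates
    candidates-ok = All.tabulate (λ X∈ → proj₂ (∈-filter⁻ candidate? {xs = shortLists} X∈))

    largest : List (V H)
    largest = argmax length [] candidates

    largest-ok : Unique largest × P largest
    largest-ok = argmax-all length ([] , P[]) candidates-ok

    largest-max : ∀ X → Unique X → P X → length X ≤ length largest
    largest-max X uniq pX = All.lookup (f[xs]≤f[argmax] [] candidates)
      (∈-filter⁺ candidate?
        (∈-listsOfLength≤ (λ {x} _ → complete H x) (unique-⊆⇒length≤ uniq (λ {x} _ → complete H x)))
        (uniq , pX))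

  IsMaxCard-cong : ∀ {P Q : List (V H) → Set} {m} →
    (∀ {X} → P X → Q X) → (∀ {X} → Q X → P X) → IsMaxCard H P m → IsMaxCard H Q m
  IsMaxCard-cong P⇒Q Q⇒P ((X , uniq , pX , len) , max) =
    (X , uniq , P⇒Q pX , len) , λ Y uniqY qY → max Y uniqY (Q⇒P qY)

  independent? : Decidable (IsIndependent H)
  independent? X = map′ (λ ind u v u∈ v∈ → All.lookup (All.lookup ind u∈) v∈)
                        (λ ind → All.tabulate (λ u∈ → All.tabulate (λ v∈ → ind _ _ u∈ v∈)))
                        (All.all? (λ u → All.all? (λ v → ¬? (adj? H u v)) X) X)

  closedNbhd? : ∀ u w → Dec (N[_]∋_ H u w)
  closedNbhd? u w = (_≟_ H w u) ⊎-dec adj? H u w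

  WithinDistance2 : Set
  WithinDistance2 = ∀ u v → ∃[ n ] (n ≤ 2 × Walk H u v n)

  ClosedNbhdsMeet : Set
  ClosedNbhdsMeet = ∀ u v → ∃[ w ] (N[_]∋_ H u w × N[_]∋_ H v w)

  withinDistance2⇒closedNbhdsMeet : WithinDistance2 → ClosedNbhdsMeet
  withinDistance2⇒closedNbhdsMeet dist₂ u v with dist₂ u v
  ... | _ , _                , []                    = u , inj₁ refl , inj₁ refl
  ... | _ , _                , a ∷ []                = v , inj₂ a , inj₁ refl
  ... | _ , _                , a ∷ (b ∷ [])          = _ , inj₂ a , inj₂ (sym-adj H b)
  ... | _ , s≤s (s≤s ())     , _ ∷ (_ ∷ (_ ∷ _))

  closedNbhdsMeet⇒withinDistance2 : ClosedNbhdsMeet → WithinDistance2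
  closedNbhdsMeet⇒withinDistance2 meet u v with meet u v
  ... | _ , inj₁ refl , inj₁ refl = 0 , z≤n , []
  ... | _ , inj₁ refl , inj₂ b    = 1 , s≤s z≤n , sym-adj H b ∷ []
  ... | _ , inj₂ a    , inj₁ refl = 1 , s≤s z≤n , a ∷ []
  ... | _ , inj₂ a    , inj₂ b    = 2 , s≤s (s≤s z≤n) , a ∷ (sym-adj H b ∷ [])

  internal-of-short-walk : ∀ {u v n x} (p : Walk H u v n) → n ≤ 2 → Internal H p x → Adj H u x
  internal-of-short-walk (a ∷ (_ ∷ [])) _ (inj₁ refl) = a
  internal-of-short-walk (_ ∷ (_ ∷ [])) _ (inj₂ ())
  internal-of-short-walk (_ ∷ (_ ∷ (_ ∷ _))) (s≤s (s≤s ())) _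

  two-step-walk-shortest : ∀ {u w} → ¬ N[_]∋_ H u w → (p : Walk H u w 2) → IsShortest H p
  two-step-walk-shortest u∌w _ zero          []       = ⊥-elim (u∌w (inj₁ refl))
  two-step-walk-shortest u∌w _ (suc zero)    (a ∷ []) = ⊥-elim (u∌w (inj₂ a))
  two-step-walk-shortest u∌w _ (suc (suc m)) _        = s≤s (s≤s z≤n)

  independent⇒positionable : WithinDistance2 → ∀ {X} → IsIndependent H X →
    ∀ {u} v → u ∈ X → Positionable H X u v
  independent⇒positionable dist₂ ind {u} v u∈X n p p-shortest x x-internal x∈X
    with dist₂ u v
  ... | m , m≤2 , q = ind u x u∈X x∈X
    (internal-of-short-walk p (≤-trans (p-shortest m q) m≤2) x-internal)

  independent⇒outerGP : WithinDistance2 → ∀ {X} → IsIndependent H X → IsOuterGP H X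
  independent⇒outerGP dist₂ ind =
    (λ _ v u∈X _ → independent⇒positionable dist₂ ind v u∈X) ,
    (λ _ v u∈X _ → independent⇒positionable dist₂ ind v u∈X)

  outerGP⇒positionable : ∀ {X} → IsOuterGP H X → ∀ {u} v → u ∈ X → Positionable H X u v
  outerGP⇒positionable {X} (inner , outer) v u∈X with _∈?_ (_≟_ H) v X
  ... | yes v∈X = inner _ v u∈X v∈X
  ... | no  v∉X = outer _ v u∈X v∉X

  outerGP-adjacent⇒N[]⊆ : ∀ {X u v} → IsOuterGP H X → u ∈ X → v ∈ X → Adj H u v →
    ∀ w → N[_]∋_ H u w → N[_]∋_ H v w
  outerGP-adjacent⇒N[]⊆ gp u∈X v∈X uv w u∋w with closedNbhd? _ w
  ... | yes v∋w = v∋w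
  ... | no  v∌w with u∋w
  ...   | inj₁ refl = ⊥-elim (v∌w (inj₂ (sym-adj H uv)))
  ...   | inj₂ uw   = ⊥-elim (outerGP⇒positionable gp w v∈X 2 path (two-step-walk-shortest v∌w path) _ (inj₁ refl) u∈X)
    where
    path : Walk H _ w 2
    path = sym-adj H uv ∷ (uw ∷ [])

  outerGP⇒independent : NoTrueTwins H → ∀ {X} → IsOuterGP H X → IsIndependent H X
  outerGP⇒independent noTwins gp u v u∈X v∈X uv = noTwins u v u≢v twins
    where
    u≢v : ¬ u ≡ v
    u≢v refl = irrefl H uv

    twins : TrueTwins H u v
    twins w = outerGP-adjacent⇒N[]⊆ gp u∈X v∈X uv w , outerGP-adjacent⇒N[]⊆ gp v∈X u∈X (sym-adj H uv) w

module _ (G H : Graph) where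

  N[]-⊠⁻ : ∀ {g g' h h'} → N[_]∋_ (G ⊠ H) (g , h) (g' , h') → N[_]∋_ G g g' × N[_]∋_ H h h'
  N[]-⊠⁻ (inj₁ refl)                      = inj₁ refl , inj₁ refl
  N[]-⊠⁻ (inj₂ (inj₁ (refl , hh')))       = inj₁ refl , inj₂ hh'
  N[]-⊠⁻ (inj₂ (inj₂ (inj₁ (gg' , refl)))) = inj₂ gg' , inj₁ refl
  N[]-⊠⁻ (inj₂ (inj₂ (inj₂ (gg' , hh'))))  = inj₂ gg' , inj₂ hh'

  N[]-⊠⁺ : ∀ {g g' h h'} → N[_]∋_ G g g' → N[_]∋_ H h h' → N[_]∋_ (G ⊠ H) (g , h) (g' , h')
  N[]-⊠⁺ (inj₁ refl) (inj₁ refl) = inj₁ refl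
  N[]-⊠⁺ (inj₁ refl) (inj₂ hh')  = inj₂ (inj₁ (refl , hh'))
  N[]-⊠⁺ (inj₂ gg')  (inj₁ refl) = inj₂ (inj₂ (inj₁ (gg' , refl)))
  N[]-⊠⁺ (inj₂ gg')  (inj₂ hh')  = inj₂ (inj₂ (inj₂ (gg' , hh')))

  closedNbhdsMeet-⊠ : ClosedNbhdsMeet G → ClosedNbhdsMeet H → ClosedNbhdsMeet (G ⊠ H)
  closedNbhdsMeet-⊠ meetG meetH (g , h) (g' , h') with meetG g g' | meetH h h'
  ... | a , g∋a , g'∋a | b , h∋b , h'∋b = (a , b) , N[]-⊠⁺ g∋a h∋b , N[]-⊠⁺ g'∋a h'∋b

  N[]⊆-⊠⁻ : ∀ {g g' h h'} →
    (∀ w → N[_]∋_ (G ⊠ H) (g , h) w → N[_]∋_ (G ⊠ H) (g' , h') w) →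
    (∀ a → N[_]∋_ G g a → N[_]∋_ G g' a) × (∀ b → N[_]∋_ H h b → N[_]∋_ H h' b)
  N[]⊆-⊠⁻ {g} {h = h} N[gh]⊆N[g'h'] =
    (λ a g∋a → proj₁ (N[]-⊠⁻ (N[gh]⊆N[g'h'] (a , h) (N[]-⊠⁺ g∋a (inj₁ refl))))) ,
    (λ b h∋b → proj₂ (N[]-⊠⁻ (N[gh]⊆N[g'h'] (g , b) (N[]-⊠⁺ (inj₁ refl) h∋b))))

  trueTwins-⊠⁻ : ∀ {g g' h h'} → TrueTwins (G ⊠ H) (g , h) (g' , h') →
    TrueTwins G g g' × TrueTwins H h h'
  trueTwins-⊠⁻ {g} {g'} {h} {h'} twins =
    (λ a → proj₁ forward a , proj₁ backward a) , (λ b → proj₂ forward b , proj₂ backward b)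
    where
    forward : (∀ a → N[_]∋_ G g a → N[_]∋_ G g' a) × (∀ b → N[_]∋_ H h b → N[_]∋_ H h' b)
    forward = N[]⊆-⊠⁻ (λ w → proj₁ (twins w))

    backward : (∀ a → N[_]∋_ G g' a → N[_]∋_ G g a) × (∀ b → N[_]∋_ H h' b → N[_]∋_ H h b)
    backward = N[]⊆-⊠⁻ (λ w → proj₂ (twins w))

  noTrueTwins-⊠ : NoTrueTwins G → NoTrueTwins H → NoTrueTwins (G ⊠ H)
  noTrueTwins-⊠ noTwinsG noTwinsH (g , h) (g' , h') gh≢g'h' twins with _≟_ G g g'
  ... | yes refl = noTwinsH h h' (λ h≡h' → gh≢g'h' (cong (g ,_) h≡h')) (proj₂ (trueTwins-⊠⁻ twins))
  ... | no  g≢g' = noTwinsG g g' g≢g' (proj₁ (trueTwins-⊠⁻ twins))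

^⊠-closed : (P : Graph → Set) → (∀ {G H} → P G → P H → P (G ⊠ H)) →
  ∀ {G} → P G → ∀ k → P (G ^⊠ suc k)
^⊠-closed P P-⊠ pG zero    = pG
^⊠-closed P P-⊠ pG (suc k) = P-⊠ pG (^⊠-closed P P-⊠ pG k)

proposition4p5 : (G : Graph) → Connected G → Diameter G 2 → NoTrueTwins G →
    (k : ℕ) → 1 ≤ k →
    ∃[ m ] (GpoNumber (G ^⊠ k) m × IndependenceNumber (G ^⊠ k) m)
proposition4p5 G _ _ _ zero ()
proposition4p5 G _ (dist₂ , _) noTwins (suc k) _ =
  proj₁ α , IsMaxCard-cong Gᵏ (independent⇒outerGP Gᵏ dist₂ᵏ) (outerGP⇒independent Gᵏ noTwinsᵏ) (proj₂ α) , proj₂ α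
  where
  Gᵏ : Graph
  Gᵏ = G ^⊠ suc k

  dist₂ᵏ : WithinDistance2 Gᵏ
  dist₂ᵏ = closedNbhdsMeet⇒withinDistance2 Gᵏ
    (^⊠-closed ClosedNbhdsMeet (λ {G} {H} → closedNbhdsMeet-⊠ G H) (withinDistance2⇒closedNbhdsMeet G dist₂) k)

  noTwinsᵏ : NoTrueTwins Gᵏ
  noTwinsᵏ = ^⊠-closed NoTrueTwins (λ {G} {H} → noTrueTwins-⊠ G H) noTwins k

  α : ∃[ m ] IndependenceNumber Gᵏ m
  α = maxCard-exists Gᵏ (IsIndependent Gᵏ) (independent? Gᵏ) (λ _ _ ())
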